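{- Let $G$ be a finite simple graph and let $uv\in E(G)$ be an edge. Then $noc(G-uv)\ge noc(G)$, where $G-uv$ denotes the graph obtained from $G$ by deleting the edge $uv$.
   Context: For a finite simple undirected graph $G=(V,E)$, a set $S\subseteq V$ is called $P_3$-convex if for every path $x$--$z$--$y$ in $G$ (i.e. distinct vertices $x,z,y$ with $xz,zy\in E$) with $x,y\in S$, we also have $z\in S$. Equivalently, every vertex outside $S$ has at most one neighbor in $S$. The number $noc(G)$ denotes the number of $P_3$-convex subsets of $V$ (including $\emptyset$ and $V$). -}

module Defs where

open import Data.Nat using (ℕ; zero; suc)
open import Data.Bool using (Bool; true; false; _∧_; _∨_; not)
open import Data.Bool.Properties using (∧-comm; ∨-comm)
open import Data.Fin using (Fin)
open import Data.Fin.Properties using (_≟_)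
open import Data.Vec using (Vec; []; _∷_; lookup)
open import Data.List using (List; []; _∷_; map; _++_; length; filter)
open import Data.Fin.Subset using (Subset; _∈_)
open import Data.Fin.Subset.Properties using (_∈?_)
open import Relation.Binary.PropositionalEquality using (_≡_; refl)
open import Relation.Nullary using (¬_; Dec; yes; no; does)
open import Relation.Nullary.Decidable using (¬?; _×-dec_; _→-dec_)
open import Data.Product using (_×_)
open import Data.Fin.Properties using (all?)

record Graph (n : ℕ) : Set where
  field
    adj   : Fin n → Fin n → Bool
    sym   : ∀ x y → adj x y ≡ adj y x
    irrefl : ∀ x → adj x x ≡ false
open Graph public

Edge : ∀ {n} → Graph n → Fin n → Fin n → Set
Edge G x y = adj G x y ≡ true

IsP3Convex : ∀ {n} → Graph n → Subset n → Set
IsP3Convex {n} G S =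
  ∀ (x z y : Fin n) → ¬ (x ≡ z) → ¬ (z ≡ y) → ¬ (x ≡ y) →
  Edge G x z → Edge G z y → x ∈ S → y ∈ S → z ∈ S

private
  edge? : ∀ {n} (G : Graph n) x y → Dec (Edge G x y)
  edge? G x y with adj G x y
  ... | true  = yes refl
  ... | false = no (λ ())

isP3Convex? : ∀ {n} (G : Graph n) (S : Subset n) → Dec (IsP3Convex G S)
isP3Convex? G S =
  all? λ x → all? λ z → all? λ y →
    ¬? (x ≟ z) →-dec (¬? (z ≟ y) →-dec (¬? (x ≟ y) →-dec
    (edge? G x z →-dec (edge? G z y →-dec
    ((x ∈? S) →-dec ((y ∈? S) →-dec (z ∈? S)))))))

allSubsets : (n : ℕ) → List (Subset n)
allSubsets zero    = [] ∷ []
allSubsets (suc n) = map (true ∷_) (allSubsets n) ++ map (false ∷_) (allSubsets n)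

noc : ∀ {n} → Graph n → ℕ
noc {n} G = length (filter (isP3Convex? G) (allSubsets n))

deleteEdge : ∀ {n} → Graph n → Fin n → Fin n → Graph n
deleteEdge {n} G u v = record
  { adj    = adj'
  ; sym    = sym'
  ; irrefl = irr'
  }
  where
  eqb : Fin n → Fin n → Bool
  eqb a b = does (a ≟ b)
  isUV : Fin n → Fin n → Bool
  isUV x y = (eqb x u ∧ eqb y v) ∨ (eqb x v ∧ eqb y u)
  adj' : Fin n → Fin n → Bool
  adj' x y = adj G x y ∧ not (isUV x y)
  isUV-sym : ∀ x y → isUV x y ≡ isUV y x
  isUV-sym x y
    rewrite ∧-comm (eqb x u) (eqb y v) | ∧-comm (eqb x v) (eqb y u)
    = ∨-comm (eqb y v ∧ eqb x u) (eqb y u ∧ eqb x v)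
  sym' : ∀ x y → adj' x y ≡ adj' y x
  sym' x y rewrite sym G x y | isUV-sym x y = refl
  irr' : ∀ x → adj' x x ≡ false
  irr' x rewrite irrefl G x = refl

{-# OPTIONS --safe #-}
-- Deleting an edge destroys P₃-paths and creates none, so every P₃-convex set
-- of G stays P₃-convex in G − uv.
module Submission where

open import Defs
open import Data.Nat using (ℕ; _≤_; _≥_)
open import Data.Fin using (Fin)
open import Data.Fin.Subset using (Subset)
open import Data.Bool using (true)
open import Data.List.Relation.Binary.Sublist.Propositional using (⊆-refl)
open import Data.List.Relation.Binary.Sublist.Propositional.Properties
  using (filter⁺; length-mono-≤)
open import Relation.Binary.PropositionalEquality using (refl)

infix 4 _⊆ᴱ_

_⊆ᴱ_ : ∀ {n} → Graph n → Graph n → Set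
H ⊆ᴱ G = ∀ x y → Edge H x y → Edge G x y

deleteEdge-⊆ᴱ : ∀ {n} (G : Graph n) (u v : Fin n) → deleteEdge G u v ⊆ᴱ G
deleteEdge-⊆ᴱ G u v x y _ with adj G x y
... | true = refl

IsP3Convex-antimono : ∀ {n} (G H : Graph n) → H ⊆ᴱ G →
  ∀ (S : Subset n) → IsP3Convex G S → IsP3Convex H S
IsP3Convex-antimono G H H⊆G S convex x z y x≢z z≢y x≢y xz zy x∈S y∈S =
  convex x z y x≢z z≢y x≢y (H⊆G x z xz) (H⊆G z y zy) x∈S y∈S

noc-antimono : ∀ {n} (G H : Graph n) → H ⊆ᴱ G → noc G ≤ noc H
noc-antimono {n} G H H⊆G =
  length-mono-≤ (filter⁺ (isP3Convex? G) (isP3Convex? H)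
    (λ { {S} refl → IsP3Convex-antimono G H H⊆G S }) (⊆-refl {x = allSubsets n}))

lemma2p2 : {n : ℕ} (G : Graph n) (u v : Fin n) → Edge G u v →
    noc (deleteEdge G u v) ≥ noc G
lemma2p2 G u v _ = noc-antimono G (deleteEdge G u v) (deleteEdge-⊆ᴱ G u v)
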